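{- Let $a\in\mathbb N$ and $i\in\{1,2,\dots,a+1\}$. Then $\Delta(J_i(a))=i-1$ and the Jaconian set of $J_i(a)$ is $\{v_k:1\le k\le i\}=V(J_i(a))$.
   Context: For $a\in\mathbb N$, the infinite Jaco graph $J_\infty(a)$ is the directed graph with vertex set $\{v_i:i\in\mathbb N\}$ in which every arc has the form $(v_i,v_j)$ with $i<j$, and for $i<j$, $(v_i,v_j)$ is an arc iff $(a+1)i-d^-(v_i)\ge j$, where $d^-(v_i)$ is the in-degree of $v_i$ (determined recursively). For $n\in\mathbb N$, the finite Jaco graph $J_n(a)$ is the subgraph of $J_\infty(a)$ induced on $\{v_1,\dots,v_n\}$. The degree $d(v)$ of a vertex is its degree in the underlying undirected graph (in-degree plus out-degree), $\Delta(J_n(a))$ is the maximum degree, and the Jaconian set of $J_n(a)$ is the set of vertices attaining degree $\Delta(J_n(a))$. -}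

module Defs where

open import Data.Nat using (ℕ; zero; suc; _+_; _*_; _∸_; _≤_; _<_; _≤?_; _<?_; _⊔_)
open import Data.List using (List; []; _∷_; _++_; [_]; map; upTo; foldr)
open import Data.Bool using (Bool; if_then_else_)
open import Data.Product using (_×_; _,_)
open import Relation.Nullary using (Dec)
open import Relation.Nullary.Decidable using (⌊_⌋; _×-dec_)
open import Relation.Binary.PropositionalEquality using (_≡_)

-- The vertex indices 1, 2, ..., n  (vertex v_k is represented by k).
verts : ℕ → List ℕ
verts n = map suc (upTo n)

count : {A : Set} → (A → Bool) → List A → ℕ
count p [] = 0
count p (x ∷ xs) = if p x then suc (count p xs) else count p xs

-- Jaco graph J_∞(a), parameter a.
-- inData a n = list of pairs (j , d⁻(v_j)) for j = 1..n, computed recursively;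
-- indegStep a n = d⁻(v_{n+1}) = #{ j ≤ n : (a+1) j - d⁻(v_j) ≥ n+1 }.
mutual
  inData : ℕ → ℕ → List (ℕ × ℕ)
  inData a zero = []
  inData a (suc n) = inData a n ++ [ (suc n , indegStep a n) ]

  indegStep : ℕ → ℕ → ℕ
  indegStep a n =
    count (λ { (j , d) → ⌊ suc n ≤? (suc a * j ∸ d) ⌋ }) (inData a n)

-- In-degree d⁻(v_i) of v_i in J_∞(a)  (there is no vertex v_0; value 0 there).
indeg : ℕ → ℕ → ℕ
indeg a zero = 0
indeg a (suc n) = indegStep a n

Arc : ℕ → ℕ → ℕ → Set
Arc a i j = (1 ≤ i) × (i < j) × (j ≤ suc a * i ∸ indeg a i)

arc? : ∀ a i j → Dec (Arc a i j)
arc? a i j = (1 ≤? i) ×-dec ((i <? j) ×-dec (j ≤? suc a * i ∸ indeg a i))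

-- Degree of v_k in the underlying undirected graph of J_n(a)
-- (in-degree plus out-degree within the induced subgraph on v_1..v_n).
deg : ℕ → ℕ → ℕ → ℕ
deg a n k = count (λ j → ⌊ arc? a j k ⌋) (verts n) + count (λ j → ⌊ arc? a k j ⌋) (verts n)

maxDeg : ℕ → ℕ → ℕ
maxDeg a n = foldr _⊔_ 0 (map (deg a n) (verts n))

Jaconian : ℕ → ℕ → ℕ → Set
Jaconian a n k = (1 ≤ k) × (k ≤ n) × (deg a n k ≡ maxDeg a n)

-- For i ≤ a + 1 every earlier vertex v_j (j < i) has in-degree j − 1, so its
-- reach (a + 1) j − (j − 1) is at least a + 1: by strong induction, the vertices
-- v_1, …, v_{a+1} are pairwise joined by arcs and have in-degrees 0, 1, …, a.
-- Hence J_i(a) is the transitive tournament on i vertices, which is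
-- (i − 1)-regular, so every vertex attains the maximum degree i − 1.
module Submission where

open import Defs
open import Data.Nat using (ℕ; zero; suc; _+_; _*_; _∸_; _≤_; _<_; _≤?_; _<?_; _⊔_; _⊓_; z≤n; s≤s)
open import Data.Nat.Properties
open import Data.Nat.Induction using (<-rec)
open import Data.List using (List; []; _∷_; _++_; [_]; map; upTo; foldr; length)
open import Data.List.Properties using (upTo-∷ʳ; map-++; length-map; length-upTo)
open import Data.List.Relation.Unary.All using (All; []; _∷_)
open import Data.List.Relation.Unary.All.Properties using (map⁺; applyUpTo⁺₁)
open import Data.Bool using (Bool; true; false; T)
open import Data.Product using (_×_; _,_)
open import Data.Empty using (⊥-elim)
open import Relation.Nullary using (Dec; yes; no)
open import Relation.Nullary.Decidable using (⌊_⌋; fromWitness; isYes≗does; does-⇔)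
open import Relation.Binary.PropositionalEquality using (_≡_; refl; sym; trans; cong; cong₂; module ≡-Reasoning)
open import Function.Bundles using (_⇔_; mk⇔)

⌊⌋-⇔ : {A B : Set} → A ⇔ B → (a? : Dec A) (b? : Dec B) → ⌊ a? ⌋ ≡ ⌊ b? ⌋
⌊⌋-⇔ A⇔B a? b? = trans (isYes≗does a?) (trans (does-⇔ A⇔B a? b?) (sym (isYes≗does b?)))

module _ {A : Set} where

  count-++ : (p : A → Bool) (xs ys : List A) → count p (xs ++ ys) ≡ count p xs + count p ys
  count-++ p [] ys = refl
  count-++ p (x ∷ xs) ys with p x
  ... | true  = cong suc (count-++ p xs ys)
  ... | false = count-++ p xs ys

  count-map : {B : Set} (p : B → Bool) (f : A → B) (xs : List A) →
              count p (map f xs) ≡ count (λ x → p (f x)) xs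
  count-map p f [] = refl
  count-map p f (x ∷ xs) with p (f x)
  ... | true  = cong suc (count-map p f xs)
  ... | false = count-map p f xs

  count-cong : {p q : A → Bool} {xs : List A} → All (λ x → p x ≡ q x) xs → count p xs ≡ count q xs
  count-cong [] = refl
  count-cong {p} {q} {x ∷ xs} (px≡qx ∷ eqs) with p x | q x
  ... | true  | true  = cong suc (count-cong eqs)
  ... | false | false = count-cong eqs
  count-cong (() ∷ _) | true  | false
  count-cong (() ∷ _) | false | true

  count-all : (p : A → Bool) {xs : List A} → All (λ x → T (p x)) xs → count p xs ≡ length xs
  count-all p [] = refl
  count-all p {x ∷ xs} (px ∷ ps) with p x
  ... | true  = cong suc (count-all p ps)
  ... | false = ⊥-elim px

foldr-⊔-const : ∀ {c} x xs → All (_≡ c) (x ∷ xs) → foldr _⊔_ 0 (x ∷ xs) ≡ c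
foldr-⊔-const {c} x xs (refl ∷ eqs) = m≥n⇒m⊔n≡m (bound xs eqs)
  where
  bound : ∀ ys → All (_≡ c) ys → foldr _⊔_ 0 ys ≤ c
  bound []       []           = z≤n
  bound (y ∷ ys) (refl ∷ eqs) = ⊔-lub ≤-refl (bound ys eqs)

verts-suc : ∀ n → verts (suc n) ≡ verts n ++ [ suc n ]
verts-suc n = trans (cong (map suc) (sym (upTo-∷ʳ n))) (map-++ suc (upTo n) [ n ])

length-verts : ∀ n → length (verts n) ≡ n
length-verts n = trans (length-map suc (upTo n)) (length-upTo n)

All-verts : ∀ {P : ℕ → Set} n → (∀ {j} → 1 ≤ j → j ≤ n → P j) → All P (verts n)
All-verts n Pj = map⁺ (applyUpTo⁺₁ (λ j → j) n (λ j<n → Pj (s≤s z≤n) j<n))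

count-verts-suc : (p : ℕ → Bool) (n : ℕ) → count p (verts (suc n)) ≡ count p (verts n) + count p [ suc n ]
count-verts-suc p n = trans (cong (count p) (verts-suc n)) (count-++ p (verts n) [ suc n ])

count-<-verts : ∀ k n → count (λ j → ⌊ j <? k ⌋) (verts n) ≡ n ⊓ (k ∸ 1)
count-<-verts k zero = refl
count-<-verts k (suc n)
  rewrite count-verts-suc (λ j → ⌊ j <? k ⌋) n | count-<-verts k n
  with suc n <? k
... | yes sn<k = let sn≤k∸1 = ∸-monoˡ-≤ 1 sn<k in
  trans (cong (_+ 1) (m≤n⇒m⊓n≡m (≤-trans (n≤1+n n) sn≤k∸1)))
        (trans (+-comm n 1) (sym (m≤n⇒m⊓n≡m sn≤k∸1)))
... | no sn≮k = let k∸1≤n = ∸-monoˡ-≤ 1 (≮⇒≥ sn≮k) in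
  trans (+-identityʳ _) (trans (m≥n⇒m⊓n≡n k∸1≤n) (sym (m≥n⇒m⊓n≡n (≤-trans k∸1≤n (n≤1+n n)))))

count->-verts : ∀ k n → count (λ j → ⌊ k <? j ⌋) (verts n) ≡ n ∸ k
count->-verts k zero = sym (0∸n≡0 k)
count->-verts k (suc n)
  rewrite count-verts-suc (λ j → ⌊ k <? j ⌋) n | count->-verts k n
  with k <? suc n
... | yes (s≤s k≤n) = trans (+-comm (n ∸ k) 1) (sym (+-∸-assoc 1 k≤n))
... | no k≮sn = let sn≤k = ≮⇒≥ k≮sn in
  trans (+-identityʳ _) (trans (m≤n⇒m∸n≡0 (≤-trans (n≤1+n n) sn≤k)) (sym (m≤n⇒m∸n≡0 sn≤k)))

⊓-pred-+-∸ : ∀ {n k} → 1 ≤ k → k ≤ n → n ⊓ (k ∸ 1) + (n ∸ k) ≡ n ∸ 1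
⊓-pred-+-∸ {suc n} {suc k} _ (s≤s k≤n) = trans (cong (_+ (n ∸ k)) (m≥n⇒m⊓n≡n (≤-trans k≤n (n≤1+n n)))) (m+[n∸m]≡n k≤n)

suc≤suc*suc∸ : ∀ m n → suc m ≤ suc m * suc n ∸ n
suc≤suc*suc∸ m n = begin
  suc m                  ≡⟨ m+n∸n≡m (suc m) n ⟨
  suc m + n ∸ n          ≤⟨ ∸-monoˡ-≤ n (+-monoʳ-≤ (suc m) (m≤n*m n (suc m))) ⟩
  suc m + suc m * n ∸ n  ≡⟨ cong (_∸ n) (*-suc (suc m) n) ⟨
  suc m * suc n ∸ n      ∎
  where open ≤-Reasoning

reach : ℕ → ℕ → ℕ
reach a i = suc a * i ∸ indeg a i

inData≡ : ∀ a n → inData a n ≡ map (λ j → j , indeg a j) (verts n)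
inData≡ a zero = refl
inData≡ a (suc n) = begin
  inData a n ++ [ f (suc n) ]         ≡⟨ cong (_++ [ f (suc n) ]) (inData≡ a n) ⟩
  map f (verts n) ++ map f [ suc n ]  ≡⟨ map-++ f (verts n) [ suc n ] ⟨
  map f (verts n ++ [ suc n ])        ≡⟨ cong (map f) (verts-suc n) ⟨
  map f (verts (suc n))               ∎
  where
  open ≡-Reasoning
  f : ℕ → ℕ × ℕ
  f j = j , indeg a j

indeg-suc : ∀ a n → indeg a (suc n) ≡ count (λ j → ⌊ suc n ≤? reach a j ⌋) (verts n)
indeg-suc a n = trans (cong (count _) (inData≡ a n)) (count-map _ (λ j → j , indeg a j) (verts n))

suc≤reach : ∀ a i → 1 ≤ i → indeg a i ≡ i ∸ 1 → suc a ≤ reach a i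
suc≤reach a (suc i) _ eq rewrite eq = suc≤suc*suc∸ a i

indeg≡pred : ∀ a k → k ≤ suc a → indeg a k ≡ k ∸ 1
indeg≡pred a = <-rec (λ k → k ≤ suc a → indeg a k ≡ k ∸ 1) step
  where
  step : ∀ k → (∀ {j} → j < k → j ≤ suc a → indeg a j ≡ j ∸ 1) → k ≤ suc a → indeg a k ≡ k ∸ 1
  step zero    _  _    = refl
  step (suc n) ih sn≤sa = trans (indeg-suc a n) (trans (count-all _ (All-verts n reached)) (length-verts n))
    where
    reached : ∀ {j} → 1 ≤ j → j ≤ n → T ⌊ suc n ≤? reach a j ⌋
    reached {j} 1≤j j≤n = fromWitness
      (≤-trans sn≤sa (suc≤reach a j 1≤j (ih (s≤s j≤n) (≤-trans (m≤n⇒m≤1+n j≤n) sn≤sa))))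

Arc⇔< : ∀ a i j → 1 ≤ i → i ≤ suc a → j ≤ suc a → Arc a i j ⇔ i < j
Arc⇔< a i j 1≤i i≤sa j≤sa = mk⇔ (λ (_ , i<j , _) → i<j)
  (λ i<j → 1≤i , i<j , ≤-trans j≤sa (suc≤reach a i 1≤i (indeg≡pred a i i≤sa)))

deg≡pred : ∀ a n k → 1 ≤ k → k ≤ n → n ≤ suc a → deg a n k ≡ n ∸ 1
deg≡pred a n k 1≤k k≤n n≤sa = begin
  deg a n k                                                            ≡⟨ cong₂ _+_ in-arcs out-arcs ⟩
  count (λ j → ⌊ j <? k ⌋) (verts n) + count (λ j → ⌊ k <? j ⌋) (verts n) ≡⟨ cong₂ _+_ (count-<-verts k n) (count->-verts k n) ⟩
  n ⊓ (k ∸ 1) + (n ∸ k)                                                ≡⟨ ⊓-pred-+-∸ 1≤k k≤n ⟩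
  n ∸ 1                                                                ∎
  where
  open ≡-Reasoning
  k≤sa : k ≤ suc a
  k≤sa = ≤-trans k≤n n≤sa
  in-arcs : count (λ j → ⌊ arc? a j k ⌋) (verts n) ≡ count (λ j → ⌊ j <? k ⌋) (verts n)
  in-arcs = count-cong (All-verts n λ {j} 1≤j j≤n →
    ⌊⌋-⇔ (Arc⇔< a j k 1≤j (≤-trans j≤n n≤sa) k≤sa) (arc? a j k) (j <? k))
  out-arcs : count (λ j → ⌊ arc? a k j ⌋) (verts n) ≡ count (λ j → ⌊ k <? j ⌋) (verts n)
  out-arcs = count-cong (All-verts n λ {j} _ j≤n →
    ⌊⌋-⇔ (Arc⇔< a k j 1≤k k≤sa (≤-trans j≤n n≤sa)) (arc? a k j) (k <? j))

maxDeg-regular : ∀ a n c → 1 ≤ n → (∀ k → 1 ≤ k → k ≤ n → deg a n k ≡ c) → maxDeg a n ≡ c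
maxDeg-regular a (suc n) c _ regular =
  foldr-⊔-const _ _ (map⁺ (All-verts (suc n) λ {k} → regular k))

lemma2p1 : (a i : ℕ) → 1 ≤ a → 1 ≤ i → i ≤ suc a →
    (maxDeg a i ≡ i ∸ 1)
    × (∀ k → Jaconian a i k ⇔ ((1 ≤ k) × (k ≤ i)))
lemma2p1 a i _ 1≤i i≤sa = Δ≡ , λ k → mk⇔ (λ (1≤k , k≤i , _) → 1≤k , k≤i)
  (λ (1≤k , k≤i) → 1≤k , k≤i , trans (deg≡pred a i k 1≤k k≤i i≤sa) (sym Δ≡))
  where
  Δ≡ : maxDeg a i ≡ i ∸ 1
  Δ≡ = maxDeg-regular a i (i ∸ 1) 1≤i λ k 1≤k k≤i → deg≡pred a i k 1≤k k≤i i≤sa
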